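{- Let $p$ and $q$ be monic polynomials of degree $m$, and let $S$ and $T$ be the U-transforms of the multisets of roots of $p$ and $q$, respectively, regarded as independent random variables, each uniformly distributed on its multiset. Then \[ [p\boxplus_m q](x)=\mathbb{E}\big[(x-S-T)^m\big]\qquad\text{and}\qquad [p\boxtimes_m q](x)=\mathbb{E}\big[(x-ST)^m\big]. \]
   Context: For a multiset $S$ of $m$ complex numbers, its U-transform is the unique multiset $T$ of $m$ complex numbers with $\prod_{s\in S}(x-s)=\frac1m\sum_{t\in T}(x-t)^m$. A multiset is identified with the random variable uniformly distributed on its elements (with multiplicity). For $p(x)=\sum_{i=0}^m x^{m-i}(-1)^ip_i$, $q(x)=\sum_{i=0}^m x^{m-i}(-1)^iq_i$, \[ [p\boxplus_m q](x)=\sum_{i+j\le m} x^{m-i-j}(-1)^{i+j}\frac{(m-i)!\,(m-j)!}{(m-i-j)!\,m!}\,p_i q_j,\qquad [p\boxtimes_m q](x)=\sum_{i=0}^m x^{m-i}(-1)^i\frac{p_iq_i}{\binom{m}{i}}. \] -}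

module Defs where

open import Level using (_⊔_)
open import Data.Nat as ℕ using (ℕ; zero; suc; _∸_; _≤ᵇ_; _!)
open import Data.Nat.Combinatorics using (_C_)
open import Data.Bool using (if_then_else_)
open import Data.Product using (Σ; proj₁)
open import Data.Vec using (Vec; foldr)
open import Algebra.Bundles using (CommutativeRing)

-- Everything is developed over a commutative ring R in which every positive
-- integer is invertible (e.g. R = ℂ).
module Poly {c ℓ} (R : CommutativeRing c ℓ) where
  open CommutativeRing R

  ι : ℕ → Carrier
  ι zero    = 0#
  ι (suc n) = 1# + ι n

  PosIntsInvertible : Set (c ⊔ ℓ)
  PosIntsInvertible = (n : ℕ) → Σ Carrier (λ y → ι (suc n) * y ≈ 1#)

  sgn : ℕ → Carrier
  sgn zero    = 1#
  sgn (suc i) = - sgn i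

  sumTo : ℕ → (ℕ → Carrier) → Carrier
  sumTo zero    f = 0#
  sumTo (suc n) f = sumTo n f + f n

  -- Polynomials in one variable x, given by their coefficient sequences:
  -- P k is the coefficient of x^k (finitely supported in all uses below).
  Pol : Set c
  Pol = ℕ → Carrier

  _≋_ : Pol → Pol → Set ℓ
  P ≋ Q = ∀ k → P k ≈ Q k

  const : Carrier → Pol
  const a zero    = a
  const a (suc k) = 0#

  X-minus : Carrier → Pol
  X-minus a zero          = - a
  X-minus a (suc zero)    = 1#
  X-minus a (suc (suc k)) = 0#

  _⊕_ : Pol → Pol → Pol
  (P ⊕ Q) k = P k + Q k

  _⊗_ : Pol → Pol → Pol
  (P ⊗ Q) k = sumTo (suc k) (λ i → P i * Q (k ∸ i))

  scale : Carrier → Pol → Pol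
  scale a P k = a * P k

  _^ᵖ_ : Pol → ℕ → Pol
  P ^ᵖ zero  = const 1#
  P ^ᵖ suc n = P ⊗ (P ^ᵖ n)

  -- Σ over a vector (a multiset listed with multiplicity)
  sumV : ∀ {n} → (Carrier → Pol) → Vec Carrier n → Pol
  sumV f = foldr _ (λ a acc → f a ⊕ acc) (λ _ → 0#)

  prodV : ∀ {n} → (Carrier → Pol) → Vec Carrier n → Pol
  prodV f = foldr _ (λ a acc → f a ⊗ acc) (const 1#)

  module WithInverses (inv : PosIntsInvertible) where

    -- 1/n for n ≥ 1 (only ever applied to positive integers)
    recip : ℕ → Carrier
    recip n = proj₁ (inv (ℕ.pred n))

    IsUTransform : (m : ℕ) → Vec Carrier m → Vec Carrier m → Set ℓ
    IsUTransform m S T =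
      prodV X-minus S ≋ scale (recip m) (sumV (λ t → X-minus t ^ᵖ m) T)

    -- paper's coefficients: P(x) = Σ_i x^{m-i} (-1)^i p_i, so p_i = (-1)^i [x^{m-i}]P
    pc : ℕ → Pol → ℕ → Carrier
    pc m P i = sgn i * P (m ∸ i)

    wt : ℕ → ℕ → ℕ → Carrier
    wt m i j = ι ((m ∸ i) ! ℕ.* (m ∸ j) !) * recip ((m ∸ i ∸ j) ! ℕ.* m !)

    boxplus : ℕ → Pol → Pol → Pol
    boxplus m P Q k =
      if k ≤ᵇ m
      then sumTo (suc (m ∸ k)) (λ i →
             sgn (m ∸ k) * wt m i (m ∸ k ∸ i) * pc m P i * pc m Q (m ∸ k ∸ i))
      else 0#

    boxtimes : ℕ → Pol → Pol → Pol
    boxtimes m P Q k =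
      if k ≤ᵇ m
      then sgn (m ∸ k) * pc m P (m ∸ k) * pc m Q (m ∸ k) * recip (m C (m ∸ k))
      else 0#

    -- E[ F(S,T) ] for independent S, T uniform on multisets of size m
    -- (F polynomial-valued): (1/m²) Σ_{s∈S} Σ_{t∈T} F(s,t)
    E₂ : (m : ℕ) → Vec Carrier m → Vec Carrier m → (Carrier → Carrier → Pol) → Pol
    E₂ m S T F = scale (recip (m ℕ.* m)) (sumV (λ s → sumV (λ t → F s t) T) S)

{-# OPTIONS --safe #-}
module Submission where

-- Expanding (x - u)^m binomially shows that the U-transform relation
-- Π_r (x - r) = (1/m) Σ_{s ∈ S} (x - s)^m says exactly p_i = C(m,i) E[S^i]:
-- the coefficients of p are scaled moments of its U-transform.  On the other
-- side, independence makes the coefficient of x^k in E[(x - S - T)^m] equal to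
-- (-1)^n C(m,k) Σ_i C(n,i) E[S^i] E[T^(n-i)] with n = m - k, and that of
-- E[(x - ST)^m] equal to (-1)^n C(m,k) E[S^n] E[T^n].  Replacing the moments
-- by the coefficients of p and q, what remains is the identity
-- C(m,i) C(m,j) (m-i)! (m-j)! / ((m-i-j)! m!) = C(i+j,i) C(m,i+j).

open import Defs
open import Level using (Level)
open import Data.Nat as ℕ
  using (ℕ; zero; suc; _∸_; _≤_; _<_; _≤ᵇ_; s≤s; NonZero; _!)
open import Data.Nat.Properties as ℕP using (_!≢0)
open import Data.Nat.Combinatorics
  using (_C_; nCk≡nC[n∸k]; k>n⇒nCk≡0; nCk+nC[k+1]≡[n+1]C[k+1]; k![n∸k]!∣n!)
open import Data.Nat.Combinatorics.Specification using (nCk≡n!/k![n-k]!)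
open import Data.Nat.DivMod using (m/n*n≡m)
open import Data.Nat.Tactic.RingSolver using (solve-∀)
open import Data.Fin using (toℕ)
open import Data.Bool using (true; false)
open import Data.Product using (_×_; _,_; proj₂)
open import Data.Vec using (Vec; []; _∷_)
open import Relation.Nullary using (yes; no)
open import Relation.Nullary.Reflects using (ofʸ; ofⁿ)
open import Relation.Binary.PropositionalEquality as ≡
  using (_≡_; cong; cong₂)
open import Algebra.Bundles using (CommutativeRing)

nCk*[k!*[n∸k]!]≡n! : ∀ {n k} → k ≤ n → (n C k) ℕ.* (k ! ℕ.* (n ∸ k) !) ≡ n !
nCk*[k!*[n∸k]!]≡n! {n} {k} k≤n = ≡.trans
  (cong (ℕ._* (k ! ℕ.* (n ∸ k) !)) (nCk≡n!/k![n-k]! k≤n))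
  (m/n*n≡m {{k ℕP.!* (n ∸ k) !≢0}} (k![n∸k]!∣n! k≤n))

nCk≢0 : ∀ {n k} → k ≤ n → NonZero (n C k)
nCk≢0 {n} {k} k≤n = ℕ.≢-nonZero λ nCk≡0 → ℕ.≢-nonZero⁻¹ (n !) {{n !≢0}}
  (≡.trans (≡.sym (nCk*[k!*[n∸k]!]≡n! k≤n)) (cong (ℕ._* (k ! ℕ.* (n ∸ k) !)) nCk≡0))

-- With j = n - i, both sides times i! j! equal (m!)².
[m∸i]!*[m∸j]!*mCi*mCj≡nCi*mCn*[m∸n]!*m! : ∀ {m n i} → i ≤ n → n ≤ m →
  let j = n ∸ i in
  (m ∸ i) ! ℕ.* (m ∸ j) ! ℕ.* ((m C i) ℕ.* (m C j))
    ≡ (n C i) ℕ.* (m C n) ℕ.* ((m ∸ n) ! ℕ.* m !)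
[m∸i]!*[m∸j]!*mCi*mCj≡nCi*mCn*[m∸n]!*m! {m} {n} {i} i≤n n≤m =
  ℕP.*-cancelʳ-≡ _ _ (i ! ℕ.* j !) {{i ℕP.!* j !≢0}} (begin
    (m ∸ i) ! * (m ∸ j) ! * ((m C i) * (m C j)) * (i ! * j !)
      ≡⟨ regroupˡ ((m ∸ i) !) ((m ∸ j) !) (m C i) (m C j) (i !) (j !) ⟩
    ((m C i) * (i ! * (m ∸ i) !)) * ((m C j) * (j ! * (m ∸ j) !))
      ≡⟨ cong₂ _*_ (nCk*[k!*[n∸k]!]≡n! i≤m) (nCk*[k!*[n∸k]!]≡n! j≤m) ⟩
    m ! * m !
      ≡⟨ cong (_* m !) (≡.sym (nCk*[k!*[n∸k]!]≡n! n≤m)) ⟩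
    (m C n) * (n ! * (m ∸ n) !) * m !
      ≡⟨ cong (λ x → (m C n) * (x * (m ∸ n) !) * m !) (≡.sym (nCk*[k!*[n∸k]!]≡n! i≤n)) ⟩
    (m C n) * ((n C i) * (i ! * j !) * (m ∸ n) !) * m !
      ≡⟨ regroupʳ (m C n) (n C i) (i !) (j !) ((m ∸ n) !) (m !) ⟩
    (n C i) * (m C n) * ((m ∸ n) ! * m !) * (i ! * j !) ∎)
  where
  open import Data.Nat.Base using (_*_)
  open ≡.≡-Reasoning
  j = n ∸ i
  i≤m : i ≤ m
  i≤m = ℕP.≤-trans i≤n n≤m
  j≤m : j ≤ m
  j≤m = ℕP.≤-trans (ℕP.m∸n≤m n i) n≤m
  regroupˡ : ∀ a b c d e f → a * b * (c * d) * (e * f) ≡ (c * (e * a)) * (d * (f * b))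
  regroupˡ = solve-∀
  regroupʳ : ∀ a b c d e f → a * (b * (c * d) * e) * f ≡ b * a * (e * f) * (c * d)
  regroupʳ = solve-∀

module Expansions {c ℓ} (R : CommutativeRing c ℓ) where
  open CommutativeRing R
  open Poly R
  open import Relation.Binary.Reasoning.Setoid setoid
  open import Algebra.Properties.Semiring.Exp semiring using (_^_)
  open import Algebra.Properties.Semiring.Mult semiring
    using (×-congʳ; ×-homo-+; ×1-homo-*; ×-assoc-*) renaming (_×_ to _×ᴹ_)
  open import Algebra.Properties.Monoid.Sum +-monoid using (sum)
  import Algebra.Properties.CommutativeSemiring.Binomial commutativeSemiring as Binomial
  open import Algebra.Properties.Ring ring using (-‿distribˡ-*; -‿distribʳ-*)
  open import Algebra.Properties.AbelianGroup +-abelianGroup using (⁻¹-involutive)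
  open import Algebra.Properties.CommutativeSemigroup *-commutativeSemigroup
    using (x∙yz≈y∙xz)
  open import Algebra.Properties.CommutativeSemigroup +-commutativeSemigroup
    using () renaming (interchange to +-interchange)

  ι≈×1# : ∀ n → ι n ≈ n ×ᴹ 1#
  ι≈×1# zero    = refl
  ι≈×1# (suc n) = +-congˡ (ι≈×1# n)

  ι-cong : ∀ {a b} → a ≡ b → ι a ≈ ι b
  ι-cong e = reflexive (cong ι e)

  ι-+ : ∀ a b → ι (a ℕ.+ b) ≈ ι a + ι b
  ι-+ a b = trans (ι≈×1# (a ℕ.+ b))
    (trans (×-homo-+ 1# a b) (sym (+-cong (ι≈×1# a) (ι≈×1# b))))

  ι-* : ∀ a b → ι (a ℕ.* b) ≈ ι a * ι b
  ι-* a b = trans (ι≈×1# (a ℕ.* b))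
    (trans (×1-homo-* a b) (sym (*-cong (ι≈×1# a) (ι≈×1# b))))

  ×≈ι* : ∀ n x → n ×ᴹ x ≈ ι n * x
  ×≈ι* n x = trans (×-congʳ n (sym (*-identityˡ x)))
    (trans (sym (×-assoc-* n 1# x)) (*-congʳ (sym (ι≈×1# n))))

  inverse-unique : ∀ {x y z} → x * y ≈ 1# → x * z ≈ 1# → y ≈ z
  inverse-unique {x} {y} {z} xy≈1 xz≈1 = begin
    y           ≈⟨ *-identityʳ y ⟨
    y * 1#      ≈⟨ *-congˡ xz≈1 ⟨
    y * (x * z) ≈⟨ *-assoc y x z ⟨
    y * x * z   ≈⟨ *-congʳ (trans (*-comm y x) xy≈1) ⟩
    1# * z      ≈⟨ *-identityˡ z ⟩
    z           ∎

  -x*-y≈x*y : ∀ x y → - x * - y ≈ x * y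
  -x*-y≈x*y x y = trans (sym (-‿distribˡ-* x (- y)))
    (trans (-‿cong (sym (-‿distribʳ-* x y))) (⁻¹-involutive (x * y)))

  sgn*sgn≈1 : ∀ n → sgn n * sgn n ≈ 1#
  sgn*sgn≈1 zero    = *-identityˡ 1#
  sgn*sgn≈1 (suc n) = trans (-x*-y≈x*y (sgn n) (sgn n)) (sgn*sgn≈1 n)

  -^≈sgn*^ : ∀ a n → (- a) ^ n ≈ sgn n * a ^ n
  -^≈sgn*^ a zero    = sym (*-identityˡ 1#)
  -^≈sgn*^ a (suc n) = begin
    - a * (- a) ^ n       ≈⟨ *-congˡ (-^≈sgn*^ a n) ⟩
    - a * (sgn n * a ^ n) ≈⟨ -‿distribˡ-* a _ ⟨
    - (a * (sgn n * a ^ n)) ≈⟨ -‿cong (x∙yz≈y∙xz a (sgn n) (a ^ n)) ⟩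
    - (sgn n * (a * a ^ n)) ≈⟨ -‿distribˡ-* (sgn n) _ ⟩
    - sgn n * a ^ suc n   ∎

  sumTo-cong : ∀ n {f g} → (∀ i → i < n → f i ≈ g i) → sumTo n f ≈ sumTo n g
  sumTo-cong zero    f≈g = refl
  sumTo-cong (suc n) f≈g =
    +-cong (sumTo-cong n (λ i i<n → f≈g i (ℕP.m<n⇒m<1+n i<n))) (f≈g n ℕP.≤-refl)

  sumTo-*ˡ : ∀ n x f → x * sumTo n f ≈ sumTo n (λ i → x * f i)
  sumTo-*ˡ zero    x f = zeroʳ x
  sumTo-*ˡ (suc n) x f = trans (distribˡ x _ _) (+-congʳ (sumTo-*ˡ n x f))

  sumTo-+ : ∀ n f g → sumTo n f + sumTo n g ≈ sumTo n (λ i → f i + g i)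
  sumTo-+ zero    f g = +-identityˡ 0#
  sumTo-+ (suc n) f g = trans (+-interchange _ _ _ _) (+-congʳ (sumTo-+ n f g))

  sumTo-suc : ∀ n f → sumTo (suc n) f ≈ f 0 + sumTo n (λ i → f (suc i))
  sumTo-suc zero    f = trans (+-identityˡ (f 0)) (sym (+-identityʳ (f 0)))
  sumTo-suc (suc n) f = trans (+-congʳ (sumTo-suc n f)) (+-assoc _ _ _)

  sum≈sumTo : ∀ n (f : ℕ → Carrier) → sum {n} (λ i → f (toℕ i)) ≈ sumTo n f
  sum≈sumTo zero    f = refl
  sum≈sumTo (suc n) f = trans (+-congˡ (sum≈sumTo n (λ i → f (suc i)))) (sym (sumTo-suc n f))

  binomial : ∀ n s t → (s + t) ^ n ≈ sumTo (suc n) (λ i → ι (n C i) * (s ^ i * t ^ (n ∸ i)))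
  binomial n s t = trans (Binomial.theorem n s t)
    (trans (sum≈sumTo (suc n) (λ i → (n C i) ×ᴹ (s ^ i * t ^ (n ∸ i))))
           (sumTo-cong (suc n) (λ i _ → ×≈ι* (n C i) _)))

  vsum : ∀ {n} → Vec Carrier n → (Carrier → Carrier) → Carrier
  vsum []      g = 0#
  vsum (a ∷ U) g = g a + vsum U g

  sumV-coeff : ∀ {n} f (U : Vec Carrier n) k → sumV f U k ≈ vsum U (λ a → f a k)
  sumV-coeff f []      k = refl
  sumV-coeff f (a ∷ U) k = +-congˡ (sumV-coeff f U k)

  vsum-cong : ∀ {n} (U : Vec Carrier n) {g h} → (∀ a → g a ≈ h a) → vsum U g ≈ vsum U h
  vsum-cong []      g≈h = refl
  vsum-cong (a ∷ U) g≈h = +-cong (g≈h a) (vsum-cong U g≈h)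

  vsum-*ˡ : ∀ {n} (U : Vec Carrier n) x g → vsum U (λ a → x * g a) ≈ x * vsum U g
  vsum-*ˡ []      x g = sym (zeroʳ x)
  vsum-*ˡ (a ∷ U) x g = trans (+-congˡ (vsum-*ˡ U x g)) (sym (distribˡ x _ _))

  vsum-sumTo : ∀ {n} (U : Vec Carrier n) N (f : ℕ → Carrier → Carrier) →
    vsum U (λ a → sumTo N (λ i → f i a)) ≈ sumTo N (λ i → vsum U (f i))
  vsum-sumTo []      N f = sym (sumTo-0 N)
    where
    sumTo-0 : ∀ N → sumTo N (λ _ → 0#) ≈ 0#
    sumTo-0 zero    = refl
    sumTo-0 (suc N) = trans (+-identityʳ _) (sumTo-0 N)
  vsum-sumTo (a ∷ U) N f = trans (+-congˡ (vsum-sumTo U N f)) (sumTo-+ N _ _)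

  X-minus-⊗-zero : ∀ a P → (X-minus a ⊗ P) 0 ≈ - a * P 0
  X-minus-⊗-zero a P = +-identityˡ _

  X-minus-⊗-suc : ∀ a P k → (X-minus a ⊗ P) (suc k) ≈ - a * P (suc k) + P k
  X-minus-⊗-suc a P k = go k (λ i → P (suc k ∸ i))
    where
    go : ∀ n (g : ℕ → Carrier) → sumTo (suc (suc n)) (λ i → X-minus a i * g i) ≈ - a * g 0 + g 1
    go zero    g = +-cong (+-identityˡ _) (*-identityˡ _)
    go (suc n) g = trans (+-cong (go n g) (zeroˡ _)) (+-identityʳ _)

  -- Guards the truncated subtraction: for k ≥ n both sides vanish because n C (k+1) = 0.
  nC[1+k]*u*u^[n∸1+k]≈nC[1+k]*u^[n∸k] : ∀ n k u →
    ι (n C suc k) * (u * u ^ (n ∸ suc k)) ≈ ι (n C suc k) * u ^ (n ∸ k)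
  nC[1+k]*u*u^[n∸1+k]≈nC[1+k]*u^[n∸k] n k u with k ℕP.<? n
  ... | yes k<n = *-congˡ (reflexive (cong (u ^_) (≡.sym (ℕP.+-∸-assoc 1 k<n))))
  ... | no  k≮n rewrite k>n⇒nCk≡0 (s≤s (ℕP.≮⇒≥ k≮n)) = trans (zeroˡ _) (sym (zeroˡ _))

  X-minus-^-coeff : ∀ a n k → (X-minus a ^ᵖ n) k ≈ ι (n C k) * (- a) ^ (n ∸ k)
  X-minus-^-coeff a zero    zero    = sym (trans (*-identityʳ _) (+-identityʳ 1#))
  X-minus-^-coeff a zero    (suc k) = sym (zeroˡ 1#)
  X-minus-^-coeff a (suc n) zero    = begin
    (X-minus a ⊗ (X-minus a ^ᵖ n)) 0 ≈⟨ X-minus-⊗-zero a (X-minus a ^ᵖ n) ⟩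
    - a * (X-minus a ^ᵖ n) 0         ≈⟨ *-congˡ (X-minus-^-coeff a n 0) ⟩
    - a * (ι 1 * (- a) ^ n)          ≈⟨ x∙yz≈y∙xz (- a) (ι 1) _ ⟩
    ι 1 * (- a) ^ suc n              ∎
  X-minus-^-coeff a (suc n) (suc k) = begin
    (X-minus a ⊗ (X-minus a ^ᵖ n)) (suc k)
      ≈⟨ X-minus-⊗-suc a (X-minus a ^ᵖ n) k ⟩
    - a * (X-minus a ^ᵖ n) (suc k) + (X-minus a ^ᵖ n) k
      ≈⟨ +-cong (*-congˡ (X-minus-^-coeff a n (suc k))) (X-minus-^-coeff a n k) ⟩
    - a * (ι (n C suc k) * u ^ (n ∸ suc k)) + ι (n C k) * u ^ (n ∸ k)
      ≈⟨ +-congʳ (x∙yz≈y∙xz u _ _) ⟩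
    ι (n C suc k) * (u * u ^ (n ∸ suc k)) + ι (n C k) * u ^ (n ∸ k)
      ≈⟨ +-congʳ (nC[1+k]*u*u^[n∸1+k]≈nC[1+k]*u^[n∸k] n k u) ⟩
    ι (n C suc k) * u ^ (n ∸ k) + ι (n C k) * u ^ (n ∸ k)
      ≈⟨ trans (+-comm _ _) (sym (distribʳ _ _ _)) ⟩
    (ι (n C k) + ι (n C suc k)) * u ^ (n ∸ k)
      ≈⟨ *-congʳ (trans (sym (ι-+ (n C k) (n C suc k))) (ι-cong (nCk+nC[k+1]≡[n+1]C[k+1] n k))) ⟩
    ι (suc n C suc k) * u ^ (n ∸ k) ∎
    where u = - a

  X-minus-^-coeff-sgn : ∀ a n k → (X-minus a ^ᵖ n) k ≈ sgn (n ∸ k) * (ι (n C k) * a ^ (n ∸ k))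
  X-minus-^-coeff-sgn a n k = trans (X-minus-^-coeff a n k)
    (trans (*-congˡ (-^≈sgn*^ a (n ∸ k)))
      (x∙yz≈y∙xz _ _ _))

  X-minus-^-coeff-high : ∀ a {n k} → n < k → (X-minus a ^ᵖ n) k ≈ 0#
  X-minus-^-coeff-high a {n} {k} n<k =
    trans (X-minus-^-coeff a n k) (trans (*-congʳ (ι-cong (k>n⇒nCk≡0 n<k))) (zeroˡ _))

module Moments {c ℓ} (R : CommutativeRing c ℓ) (inv : Poly.PosIntsInvertible R)
               (m : ℕ) .{{_ : NonZero m}} where
  open CommutativeRing R
  open Poly R
  open WithInverses inv
  open Expansions R
  open import Relation.Binary.Reasoning.Setoid setoid
  open import Algebra.Properties.Semiring.Exp semiring using (_^_)
  open import Algebra.Properties.CommutativeSemiring.Exp commutativeSemiring using (^-distrib-*)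
  open import Algebra.Properties.CommutativeSemigroup *-commutativeSemigroup
    using (interchange; x∙yz≈y∙xz; xy∙z≈xz∙y; xy∙z≈y∙xz)

  ι*recip≈1 : ∀ n .{{_ : NonZero n}} → ι n * recip n ≈ 1#
  ι*recip≈1 (suc n) = proj₂ (inv n)

  recip-* : ∀ a b .{{_ : NonZero a}} .{{_ : NonZero b}} → recip (a ℕ.* b) ≈ recip a * recip b
  recip-* a b = inverse-unique (ι*recip≈1 (a ℕ.* b) {{ℕP.m*n≢0 a b}}) (begin
    ι (a ℕ.* b) * (recip a * recip b) ≈⟨ *-congʳ (ι-* a b) ⟩
    ι a * ι b * (recip a * recip b)   ≈⟨ interchange _ _ _ _ ⟩
    ι a * recip a * (ι b * recip b)   ≈⟨ *-cong (ι*recip≈1 a) (ι*recip≈1 b) ⟩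
    1# * 1#                           ≈⟨ *-identityˡ 1# ⟩
    1#                                ∎)

  mean : Vec Carrier m → (Carrier → Carrier) → Carrier
  mean U g = recip m * vsum U g

  moment : Vec Carrier m → ℕ → Carrier
  moment U i = mean U (_^ i)

  mean-cong : ∀ U {g h} → (∀ u → g u ≈ h u) → mean U g ≈ mean U h
  mean-cong U g≈h = *-congˡ (vsum-cong U g≈h)

  mean-*ˡ : ∀ U x g → mean U (λ u → x * g u) ≈ x * mean U g
  mean-*ˡ U x g = trans (*-congˡ (vsum-*ˡ U x g)) (x∙yz≈y∙xz _ _ _)

  mean-*ʳ : ∀ U g x → mean U (λ u → g u * x) ≈ mean U g * x
  mean-*ʳ U g x = trans (mean-cong U (λ u → *-comm (g u) x)) (trans (mean-*ˡ U x g) (*-comm x _))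

  mean-sumTo : ∀ U N (f : ℕ → Carrier → Carrier) →
    mean U (λ u → sumTo N (λ i → f i u)) ≈ sumTo N (λ i → mean U (f i))
  mean-sumTo U N f = trans (*-congˡ (vsum-sumTo U N f)) (sumTo-*ˡ N (recip m) _)

  mean₂ : Vec Carrier m → Vec Carrier m → (Carrier → Carrier → Carrier) → Carrier
  mean₂ S T h = mean S (λ s → mean T (h s))

  mean₂-cong : ∀ S T {g h} → (∀ s t → g s t ≈ h s t) → mean₂ S T g ≈ mean₂ S T h
  mean₂-cong S T g≈h = mean-cong S (λ s → mean-cong T (g≈h s))

  mean₂-*ˡ : ∀ S T x h → mean₂ S T (λ s t → x * h s t) ≈ x * mean₂ S T h
  mean₂-*ˡ S T x h = trans (mean-cong S (λ s → mean-*ˡ T x (h s))) (mean-*ˡ S x _)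

  mean₂-sumTo : ∀ S T N (f : ℕ → Carrier → Carrier → Carrier) →
    mean₂ S T (λ s t → sumTo N (λ i → f i s t)) ≈ sumTo N (λ i → mean₂ S T (f i))
  mean₂-sumTo S T N f =
    trans (mean-cong S (λ s → mean-sumTo T N (λ i → f i s))) (mean-sumTo S N _)

  mean₂-independent : ∀ S T f g → mean₂ S T (λ s t → f s * g t) ≈ mean S f * mean T g
  mean₂-independent S T f g = trans (mean-cong S (λ s → mean-*ˡ T (f s) g)) (mean-*ʳ S f _)

  mean₂-zero : ∀ S T {h} → (∀ s t → h s t ≈ 0#) → mean₂ S T h ≈ 0#
  mean₂-zero S T h≈0 = trans (mean₂-cong S T (λ s t → trans (h≈0 s t) (sym (zeroˡ 0#))))
    (trans (mean₂-*ˡ S T 0# (λ _ _ → 0#)) (zeroˡ _))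

  E₂≈mean₂ : ∀ S T F k → E₂ m S T F k ≈ mean₂ S T (λ s t → F s t k)
  E₂≈mean₂ S T F k = begin
    recip (m ℕ.* m) * sumV (λ s → sumV (F s) T) S k
      ≈⟨ *-cong (recip-* m m) (trans (sumV-coeff _ S k) (vsum-cong S (λ s → sumV-coeff (F s) T k))) ⟩
    recip m * recip m * vsum S (λ s → vsum T (λ t → F s t k))
      ≈⟨ *-assoc _ _ _ ⟩
    recip m * (recip m * vsum S (λ s → vsum T (λ t → F s t k)))
      ≈⟨ *-congˡ (vsum-*ˡ S (recip m) _) ⟨
    mean₂ S T (λ s t → F s t k) ∎

  E₂-X-minus-^-high : ∀ S T (f : Carrier → Carrier → Carrier) {k} → m < k → E₂ m S T (λ s t → X-minus (f s t) ^ᵖ m) k ≈ 0#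
  E₂-X-minus-^-high S T f {k} m<k =
    trans (E₂≈mean₂ S T (λ s t → X-minus (f s t) ^ᵖ m) k)
      (mean₂-zero S T (λ s t → X-minus-^-coeff-high (f s t) m<k))

  E₂-X-minus-+-coeff : ∀ S T k → let n = m ∸ k in
    E₂ m S T (λ s t → X-minus (s + t) ^ᵖ m) k
      ≈ sgn n * (ι (m C k) * sumTo (suc n) (λ i → ι (n C i) * (moment S i * moment T (n ∸ i))))
  E₂-X-minus-+-coeff S T k = begin
    E₂ m S T (λ s t → X-minus (s + t) ^ᵖ m) k
      ≈⟨ E₂≈mean₂ S T (λ s t → X-minus (s + t) ^ᵖ m) k ⟩
    mean₂ S T (λ s t → (X-minus (s + t) ^ᵖ m) k)
      ≈⟨ mean₂-cong S T (λ s t → trans (X-minus-^-coeff-sgn (s + t) m k) (*-congˡ (*-congˡ (binomial n s t)))) ⟩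
    mean₂ S T (λ s t → sgn n * (ι (m C k) * sumTo (suc n) (term s t)))
      ≈⟨ trans (mean₂-*ˡ S T _ _) (*-congˡ (mean₂-*ˡ S T _ _)) ⟩
    sgn n * (ι (m C k) * mean₂ S T (λ s t → sumTo (suc n) (term s t)))
      ≈⟨ *-congˡ (*-congˡ (mean₂-sumTo S T (suc n) (λ i s t → term s t i))) ⟩
    sgn n * (ι (m C k) * sumTo (suc n) (λ i → mean₂ S T (λ s t → term s t i)))
      ≈⟨ *-congˡ (*-congˡ (sumTo-cong (suc n) (λ i _ →
           trans (mean₂-*ˡ S T _ _) (*-congˡ (mean₂-independent S T (_^ i) (_^ (n ∸ i))))))) ⟩
    sgn n * (ι (m C k) * sumTo (suc n) (λ i → ι (n C i) * (moment S i * moment T (n ∸ i)))) ∎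
    where
    n = m ∸ k
    term : Carrier → Carrier → ℕ → Carrier
    term s t i = ι (n C i) * (s ^ i * t ^ (n ∸ i))

  E₂-X-minus-*-coeff : ∀ S T k → let n = m ∸ k in
    E₂ m S T (λ s t → X-minus (s * t) ^ᵖ m) k ≈ sgn n * (ι (m C k) * (moment S n * moment T n))
  E₂-X-minus-*-coeff S T k = begin
    E₂ m S T (λ s t → X-minus (s * t) ^ᵖ m) k
      ≈⟨ E₂≈mean₂ S T (λ s t → X-minus (s * t) ^ᵖ m) k ⟩
    mean₂ S T (λ s t → (X-minus (s * t) ^ᵖ m) k)
      ≈⟨ mean₂-cong S T (λ s t → trans (X-minus-^-coeff-sgn (s * t) m k) (*-congˡ (*-congˡ (^-distrib-* s t n)))) ⟩
    mean₂ S T (λ s t → sgn n * (ι (m C k) * (s ^ n * t ^ n)))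
      ≈⟨ trans (mean₂-*ˡ S T _ _) (*-congˡ (mean₂-*ˡ S T _ _)) ⟩
    sgn n * (ι (m C k) * mean₂ S T (λ s t → s ^ n * t ^ n))
      ≈⟨ *-congˡ (*-congˡ (mean₂-independent S T (_^ n) (_^ n))) ⟩
    sgn n * (ι (m C k) * (moment S n * moment T n)) ∎
    where n = m ∸ k

  CoeffsAreMoments : Pol → Vec Carrier m → Set ℓ
  CoeffsAreMoments P U = ∀ i → i ≤ m → pc m P i ≈ ι (m C i) * moment U i

  UTransform⇒CoeffsAreMoments : ∀ P r U → P ≋ prodV X-minus r → IsUTransform m r U →
    CoeffsAreMoments P U
  UTransform⇒CoeffsAreMoments P r U P≋Πr U-transform i i≤m = begin
    sgn i * P (m ∸ i)
      ≈⟨ *-congˡ (trans (P≋Πr (m ∸ i)) (U-transform (m ∸ i))) ⟩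
    sgn i * (recip m * sumV (λ u → X-minus u ^ᵖ m) U (m ∸ i))
      ≈⟨ *-congˡ (*-congˡ (sumV-coeff _ U (m ∸ i))) ⟩
    sgn i * mean U (λ u → (X-minus u ^ᵖ m) (m ∸ i))
      ≈⟨ *-congˡ (mean-cong U coeff) ⟩
    sgn i * mean U (λ u → sgn i * (ι (m C i) * u ^ i))
      ≈⟨ *-congˡ (trans (mean-*ˡ U _ _) (*-congˡ (mean-*ˡ U _ _))) ⟩
    sgn i * (sgn i * (ι (m C i) * moment U i))
      ≈⟨ *-assoc _ _ _ ⟨
    sgn i * sgn i * (ι (m C i) * moment U i)
      ≈⟨ trans (*-congʳ (sgn*sgn≈1 i)) (*-identityˡ _) ⟩
    ι (m C i) * moment U i ∎
    where
    coeff : ∀ u → (X-minus u ^ᵖ m) (m ∸ i) ≈ sgn i * (ι (m C i) * u ^ i)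
    coeff u = trans (X-minus-^-coeff-sgn u m (m ∸ i)) (reflexive
      (cong₂ (λ a b → sgn a * (ι b * u ^ a)) (ℕP.m∸[m∸n]≡n i≤m) (≡.sym (nCk≡nC[n∸k] i≤m))))

  wt*mCi*mCj≈nCi*mCn : ∀ {n i} → i ≤ n → n ≤ m →
    wt m i (n ∸ i) * (ι (m C i) * ι (m C (n ∸ i))) ≈ ι (n C i) * ι (m C n)
  wt*mCi*mCj≈nCi*mCn {n} {i} i≤n n≤m = begin
    ι W * recip B * (ι (m C i) * ι (m C j))
      ≈⟨ xy∙z≈xz∙y _ _ _ ⟩
    ι W * (ι (m C i) * ι (m C j)) * recip B
      ≈⟨ *-cong (sym (trans (ι-* W _) (*-congˡ (ι-* (m C i) (m C j)))))
                (reflexive (cong (λ a → recip (a ! ℕ.* m !)) m∸i∸j≡m∸n)) ⟩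
    ι (W ℕ.* ((m C i) ℕ.* (m C j))) * recip B′
      ≈⟨ *-congʳ (ι-cong ([m∸i]!*[m∸j]!*mCi*mCj≡nCi*mCn*[m∸n]!*m! i≤n n≤m)) ⟩
    ι ((n C i) ℕ.* (m C n) ℕ.* B′) * recip B′
      ≈⟨ *-congʳ (ι-* ((n C i) ℕ.* (m C n)) B′) ⟩
    ι ((n C i) ℕ.* (m C n)) * ι B′ * recip B′
      ≈⟨ *-assoc _ _ _ ⟩
    ι ((n C i) ℕ.* (m C n)) * (ι B′ * recip B′)
      ≈⟨ *-congˡ (ι*recip≈1 B′ {{(m ∸ n) ℕP.!* m !≢0}}) ⟩
    ι ((n C i) ℕ.* (m C n)) * 1#
      ≈⟨ trans (*-identityʳ _) (ι-* (n C i) (m C n)) ⟩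
    ι (n C i) * ι (m C n) ∎
    where
    j = n ∸ i
    W = (m ∸ i) ! ℕ.* (m ∸ j) !
    B = (m ∸ i ∸ j) ! ℕ.* m !
    B′ = (m ∸ n) ! ℕ.* m !
    m∸i∸j≡m∸n : m ∸ i ∸ j ≡ m ∸ n
    m∸i∸j≡m∸n = ≡.trans (ℕP.∸-+-assoc m i j) (cong (m ∸_) (ℕP.m+[n∸m]≡n i≤n))

  boxplus≋E₂ : ∀ p q S T → CoeffsAreMoments p S → CoeffsAreMoments q T →
    boxplus m p q ≋ E₂ m S T (λ s t → X-minus (s + t) ^ᵖ m)
  boxplus≋E₂ p q S T p~S q~T k with k ≤ᵇ m | ℕP.≤ᵇ-reflects-≤ k m
  ... | false | ofⁿ k≰m = sym (E₂-X-minus-^-high S T _+_ (ℕP.≰⇒> k≰m))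
  ... | true  | ofʸ k≤m = begin
    sumTo (suc n) (λ i → sgn n * wt m i (n ∸ i) * pc m p i * pc m q (n ∸ i))
      ≈⟨ sumTo-cong (suc n) (λ i i<1+n → term (ℕP.m<1+n⇒m≤n i<1+n)) ⟩
    sumTo (suc n) (λ i → sgn n * (ι (m C k) * (ι (n C i) * (moment S i * moment T (n ∸ i)))))
      ≈⟨ trans (*-congˡ (sumTo-*ˡ (suc n) _ _)) (sumTo-*ˡ (suc n) _ _) ⟨
    sgn n * (ι (m C k) * sumTo (suc n) (λ i → ι (n C i) * (moment S i * moment T (n ∸ i))))
      ≈⟨ E₂-X-minus-+-coeff S T k ⟨
    E₂ m S T (λ s t → X-minus (s + t) ^ᵖ m) k ∎
    where
    n = m ∸ k
    n≤m : n ≤ m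
    n≤m = ℕP.m∸n≤m m k
    term : ∀ {i} → i ≤ n → sgn n * wt m i (n ∸ i) * pc m p i * pc m q (n ∸ i)
      ≈ sgn n * (ι (m C k) * (ι (n C i) * (moment S i * moment T (n ∸ i))))
    term {i} i≤n = begin
      sgn n * wt m i j * pc m p i * pc m q j
        ≈⟨ *-cong (*-congˡ (p~S i (ℕP.≤-trans i≤n n≤m))) (q~T j (ℕP.≤-trans (ℕP.m∸n≤m n i) n≤m)) ⟩
      sgn n * wt m i j * (ι (m C i) * μ) * (ι (m C j) * ν)
        ≈⟨ trans (*-assoc _ _ _) (*-assoc _ _ _) ⟩
      sgn n * (wt m i j * ((ι (m C i) * μ) * (ι (m C j) * ν)))
        ≈⟨ *-congˡ (trans (*-congˡ (interchange _ _ _ _)) (sym (*-assoc _ _ _))) ⟩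
      sgn n * (wt m i j * (ι (m C i) * ι (m C j)) * (μ * ν))
        ≈⟨ *-congˡ (*-congʳ (wt*mCi*mCj≈nCi*mCn i≤n n≤m)) ⟩
      sgn n * (ι (n C i) * ι (m C n) * (μ * ν))
        ≈⟨ *-congˡ (trans (xy∙z≈y∙xz _ _ _) (*-congʳ (ι-cong (≡.sym (nCk≡nC[n∸k] k≤m))))) ⟩
      sgn n * (ι (m C k) * (ι (n C i) * (μ * ν))) ∎
      where
      j = n ∸ i
      μ = moment S i
      ν = moment T j

  boxtimes≋E₂ : ∀ p q S T → CoeffsAreMoments p S → CoeffsAreMoments q T →
    boxtimes m p q ≋ E₂ m S T (λ s t → X-minus (s * t) ^ᵖ m)
  boxtimes≋E₂ p q S T p~S q~T k with k ≤ᵇ m | ℕP.≤ᵇ-reflects-≤ k m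
  ... | false | ofⁿ k≰m = sym (E₂-X-minus-^-high S T _*_ (ℕP.≰⇒> k≰m))
  ... | true  | ofʸ k≤m = begin
    sgn n * pc m p n * pc m q n * recip (m C n)
      ≈⟨ *-congʳ (*-cong (*-congˡ (p~S n n≤m)) (q~T n n≤m)) ⟩
    sgn n * (κ * μ) * (κ * ν) * recip (m C n)
      ≈⟨ *-assoc _ _ _ ⟩
    sgn n * (κ * μ) * ((κ * ν) * recip (m C n))
      ≈⟨ *-congˡ (trans (xy∙z≈xz∙y κ ν _) (trans (*-congʳ (ι*recip≈1 (m C n) {{nCk≢0 n≤m}})) (*-identityˡ ν))) ⟩
    sgn n * (κ * μ) * ν
      ≈⟨ trans (*-assoc _ _ _) (*-congˡ (*-assoc κ μ ν)) ⟩
    sgn n * (κ * (μ * ν))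
      ≈⟨ *-congˡ (*-congʳ (ι-cong (≡.sym (nCk≡nC[n∸k] k≤m)))) ⟩
    sgn n * (ι (m C k) * (μ * ν))
      ≈⟨ E₂-X-minus-*-coeff S T k ⟨
    E₂ m S T (λ s t → X-minus (s * t) ^ᵖ m) k ∎
    where
    n = m ∸ k
    n≤m : n ≤ m
    n≤m = ℕP.m∸n≤m m k
    κ = ι (m C n)
    μ = moment S n
    ν = moment T n

lemma3p4 : ∀ {c ℓ : Level} (R : CommutativeRing c ℓ) →
    let open CommutativeRing R in
    let open Poly R in
    (inv : PosIntsInvertible) →
    let open WithInverses inv in
    (m : ℕ) → 1 ≤ m →
    (p q : Pol) (rp rq : Vec Carrier m) →
    p ≋ prodV X-minus rp → q ≋ prodV X-minus rq →
    (S T : Vec Carrier m) → IsUTransform m rp S → IsUTransform m rq T →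
    (boxplus m p q ≋ E₂ m S T (λ s t → X-minus (s + t) ^ᵖ m))
    × (boxtimes m p q ≋ E₂ m S T (λ s t → X-minus (s * t) ^ᵖ m))
lemma3p4 R inv (suc m) _ p q rp rq p≋Πrp q≋Πrq S T S-transform T-transform =
  boxplus≋E₂ p q S T p~S q~T , boxtimes≋E₂ p q S T p~S q~T
  where
  open Moments R inv (suc m)
  p~S : CoeffsAreMoments p S
  p~S = UTransform⇒CoeffsAreMoments p rp S p≋Πrp S-transform
  q~T : CoeffsAreMoments q T
  q~T = UTransform⇒CoeffsAreMoments q rq T q≋Πrq T-transform
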